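{- Let $G$ be a connected graph with cut decomposition $(X,\mathcal{C})$, and let $x$ be a leaf of $X$. Suppose that the survivor is restricted to the vertices of $C_x$ (its position is always a vertex of $C_x$). Then $\mathrm{load}(x)$ lazy zombies, starting from any vertices of $G$, can capture the survivor in at most $\mathrm{time}(x)$ rounds.
   Context: Lazy zombies and survivor game on a connected graph $G$: each round, first every lazy zombie either stays at its current vertex $u$ or moves to a neighbour of $u$ lying on a shortest path in $G$ from $u$ to the survivor's current vertex; then the survivor stays or moves to an adjacent vertex; full information; capture means a lazy zombie occupies the survivor's vertex. $\delta(G)$ denotes the diameter of $G$. A cut decomposition of $G$ is a pair $(X,\mathcal{C})$ where $X$ is a rooted tree and $\mathcal{C}=\{C_x\subseteq V(G): x\in V(X)\}$ such that: every $v\in V(G)$ lies in $C_x$ for a unique $x$; for every edge $uv$ of $G$ there are $x,y$ with $u\in C_x$, $v\in C_y$ and $x$ an ancestor of $y$ (a node is its own ancestor); for every non-leaf node $y$, $C_y$ is a cut set of the induced subgraph $G[\bigcup_{x\in\Lambda_X(y)} C_x]$, where $\Lambda_X(y)$ is the subtree of $X$ rooted at $y$. Define $\mathrm{load}(x)=|C_x|$ if $x$ is a leaf and $\mathrm{load}(x)=|C_x|+\max_y \mathrm{load}(y)$ otherwise ($y$ ranging over children of $x$); $\mathrm{time}(x)=|C_x|(\delta(G)-1)+1$ if $x$ is a leaf and $\mathrm{time}(x)=\max_y \mathrm{time}(y)\cdot(|C_x|(\delta(G)-1)+1)$ otherwise. -}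

module Defs where

open import Data.Nat using (ℕ; zero; suc; _+_; _*_; _∸_; _≤_)
open import Data.Fin using (Fin; _≟_)
open import Data.List using (length; filter; allFin)
open import Data.Product using (Σ; ∃; _×_; _,_)
open import Data.Sum using (_⊎_)
open import Data.Maybe using (Maybe; just; nothing)
open import Relation.Nullary using (¬_)
open import Relation.Binary.PropositionalEquality using (_≡_)

record Graph : Set₁ where
  field
    n      : ℕ
    Adj    : Fin n → Fin n → Set
    sym    : ∀ {u v} → Adj u v → Adj v u
    irrefl : ∀ {u} → ¬ Adj u u

data Walk {n : ℕ} (E : Fin n → Fin n → Set) : Fin n → Fin n → ℕ → Set where
  here : ∀ {u} → Walk E u u 0
  step : ∀ {u w v k} → E u w → Walk E w v k → Walk E u v (suc k)

module _ (G : Graph) where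
  open Graph G

  Vertex : Set
  Vertex = Fin n

  Connected : Set
  Connected = ∀ u v → ∃ λ k → Walk Adj u v k

  IsDist : Vertex → Vertex → ℕ → Set
  IsDist u v d = Walk Adj u v d × (∀ k → Walk Adj u v k → d ≤ k)

  IsDiameter : ℕ → Set
  IsDiameter D = (∀ u v → ∃ λ d → IsDist u v d × d ≤ D)
               × (∃ λ u → ∃ λ v → IsDist u v D)

  InducedAdj : (Vertex → Set) → Vertex → Vertex → Set
  InducedAdj P a b = P a × P b × Adj a b

  IsCutSetOf : (S U : Vertex → Set) → Set
  IsCutSetOf S U =
    ∃ λ a → ∃ λ b → (U a × ¬ S a) × (U b × ¬ S b) ×
      (∀ k → ¬ Walk (InducedAdj (λ v → U v × ¬ S v)) a b k)

module _ {m : ℕ} (parent : Fin m → Maybe (Fin m)) where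
  data Ancestor (a : Fin m) : Fin m → Set where
    self : Ancestor a a
    up   : ∀ {y p} → parent y ≡ just p → Ancestor a p → Ancestor a y

record CutDecomposition (G : Graph) : Set₁ where
  open Graph G
  field
    m        : ℕ                          -- number of nodes of X
    parent   : Fin m → Maybe (Fin m)
    root     : Fin m
    root-top : parent root ≡ nothing
    rooted   : ∀ y → Ancestor parent root y
    -- part v = the unique node x with v ∈ C_x
    part     : Fin n → Fin m
  C : Fin m → Fin n → Set
  C x v = part v ≡ x
  IsLeaf : Fin m → Set
  IsLeaf x = ∀ z → ¬ (parent z ≡ just x)
  -- vertices of ⋃_{x ∈ Λ_X(y)} C_x
  Below : Fin m → Fin n → Set
  Below y v = Ancestor parent y (part v)
  field
    edges : ∀ {u v} → Adj u v →
              Ancestor parent (part u) (part v) ⊎ Ancestor parent (part v) (part u)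
    cuts  : ∀ y → ¬ IsLeaf y → IsCutSetOf G (C y) (Below y)
  size : Fin m → ℕ
  size x = length (filter (λ v → part v ≟ x) (allFin n))

module _ (G : Graph) (P : Fin (Graph.n G) → Set) (k : ℕ) where
  open Graph G

  Positions : Set
  Positions = Fin k → Fin n

  Caught : Positions → Fin n → Set
  Caught zs s = ∃ λ i → zs i ≡ s

  ZombieMove : Positions → Fin n → Positions → Set
  ZombieMove zs s zs' = ∀ i → zs' i ≡ zs i ⊎
    (Adj (zs i) (zs' i) × ∃ λ d → IsDist G (zs' i) s d × IsDist G (zs i) s (suc d))

  SurvivorMove : Fin n → Fin n → Set
  SurvivorMove s s' = P s' × (s' ≡ s ⊎ Adj s s')

  -- ZombiesWin t zs s : zombies at zs, survivor at s, a round is about to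
  -- begin; the zombies can force capture within at most t further rounds
  ZombiesWin : ℕ → Positions → Fin n → Set
  ZombiesWin zero    zs s = Caught zs s
  ZombiesWin (suc t) zs s = Caught zs s ⊎
    (∃ λ zs' → ZombieMove zs s zs' ×
       (Caught zs' s ⊎ (∀ s' → SurvivorMove s s' → ZombiesWin t zs' s')))

{-# OPTIONS --safe #-}
module Submission where

-- Give each vertex v i of C x its own zombie i. When the survivor stands on
-- v j, zombie j takes one step along a shortest path towards it and all
-- other zombies stay put. The potential Σ i (d(z i , v i) ∸ 1) starts at
-- most |C x| (δ − 1) and strictly drops in every round that does not end in
-- a capture, so the survivor is caught within |C x| (δ − 1) + 1 rounds.

open import Defs
open import Data.Nat using (ℕ; zero; suc; _+_; _*_; _∸_; _≤_; _<_; z≤n; s≤s)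
open import Data.Nat.Properties
open import Data.Fin using (Fin; zero; suc) renaming (_≟_ to _≟ᶠ_)
open import Data.Vec.Functional using (Vector; updateAt)
open import Data.Vec.Functional.Properties using (updateAt-updates; updateAt-minimal)
open import Data.List using (List; filter; allFin; lookup)
open import Data.List.Relation.Unary.Any using (index)
open import Data.List.Relation.Unary.Any.Properties using (lookup-index)
open import Data.List.Membership.Propositional.Properties using (∈-filter⁺; ∈-allFin)
open import Data.Product using (∃; _×_; _,_; proj₁; proj₂)
open import Data.Sum using (_⊎_; inj₁; inj₂)
open import Function using (const)
open import Relation.Nullary using (yes; no)
open import Relation.Binary.PropositionalEquality using (_≡_; refl; sym; trans; cong; subst; module ≡-Reasoning)
open import Algebra.Properties.Monoid.Sum +-0-monoid using (sum)

sum-mono-≤ : ∀ {n} {xs ys : Vector ℕ n} → (∀ i → xs i ≤ ys i) → sum xs ≤ sum ys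
sum-mono-≤ {zero}  _     = z≤n
sum-mono-≤ {suc n} xs≤ys = +-mono-≤ (xs≤ys zero) (sum-mono-≤ (λ i → xs≤ys (suc i)))

sum-mono-< : ∀ {n} {xs ys : Vector ℕ n} → (∀ i → xs i ≤ ys i) →
             ∀ j → xs j < ys j → sum xs < sum ys
sum-mono-< xs≤ys zero    xj<yj = +-mono-<-≤ xj<yj (sum-mono-≤ (λ i → xs≤ys (suc i)))
sum-mono-< xs≤ys (suc j) xj<yj = +-mono-≤-< (xs≤ys zero) (sum-mono-< (λ i → xs≤ys (suc i)) j xj<yj)

sum-≤-* : ∀ {n} {xs : Vector ℕ n} {b} → (∀ i → xs i ≤ b) → sum xs ≤ n * b
sum-≤-* {zero}  _    = z≤n
sum-≤-* {suc n} xs≤b = +-mono-≤ (xs≤b zero) (sum-≤-* (λ i → xs≤b (suc i)))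

m*0+1∸m≡0 : ∀ {m} → Fin m → m * 0 + 1 ∸ m ≡ 0
m*0+1∸m≡0 {suc m} _ = trans (cong (λ z → z + 1 ∸ suc m) (*-zeroʳ m)) (0∸n≡0 m)

m*[1+n]+1∸m≡1+m*n : ∀ m n → m * suc n + 1 ∸ m ≡ suc (m * n)
m*[1+n]+1∸m≡1+m*n m n = begin
  m * suc n + 1 ∸ m   ≡⟨ cong (λ z → z + 1 ∸ m) (*-suc m n) ⟩
  m + m * n + 1 ∸ m   ≡⟨ cong (_∸ m) (+-assoc m (m * n) 1) ⟩
  m + (m * n + 1) ∸ m ≡⟨ m+n∸m≡n m (m * n + 1) ⟩
  m * n + 1           ≡⟨ +-comm (m * n) 1 ⟩
  suc (m * n)         ∎
  where open ≡-Reasoning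

module _ (G : Graph) where
  open Graph G using (Adj)

  IsDist-unique : ∀ {u v a b} → IsDist G u v a → IsDist G u v b → a ≡ b
  IsDist-unique (walkᵃ , minᵃ) (walkᵇ , minᵇ) = ≤-antisym (minᵃ _ walkᵇ) (minᵇ _ walkᵃ)

  IsDist-zero⇒≡ : ∀ {u v} → IsDist G u v 0 → u ≡ v
  IsDist-zero⇒≡ (here , _) = refl

  IsDist-suc⇒step : ∀ {u v d} → IsDist G u v (suc d) → ∃ λ w → Adj u w × IsDist G w v d
  IsDist-suc⇒step (step {w = w} u~w walk , min) =
    w , u~w , walk , λ k walk′ → ≤-pred (min (suc k) (step u~w walk′))

module CoveredRegion (G : Graph) {D : ℕ} (diam : IsDiameter G D) (P : Vertex G → Set)
                     {k : ℕ} (target : Fin k → Vertex G)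
                     (covers : ∀ s → P s → ∃ λ j → target j ≡ s) where
  open Graph G using (Adj)

  dist : Vertex G → Vertex G → ℕ
  dist u v = proj₁ (proj₁ diam u v)

  dist-isDist : ∀ u v → IsDist G u v (dist u v)
  dist-isDist u v = proj₁ (proj₂ (proj₁ diam u v))

  dist≤D : ∀ u v → dist u v ≤ D
  dist≤D u v = proj₂ (proj₂ (proj₁ diam u v))

  IsDist⇒dist≡ : ∀ {u v d} → IsDist G u v d → dist u v ≡ d
  IsDist⇒dist≡ = IsDist-unique G (dist-isDist _ _)

  slack : Positions G P k → Fin k → ℕ
  slack zs i = dist (zs i) (target i) ∸ 1

  potential : Positions G P k → ℕ
  potential zs = sum (slack zs)

  potential≤ : ∀ zs → potential zs ≤ k * (D ∸ 1)
  potential≤ zs = sum-≤-* (λ i → ∸-monoˡ-≤ 1 (dist≤D (zs i) (target i)))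

  advance : Positions G P k → Fin k → Vertex G → Positions G P k
  advance zs j w = updateAt zs j (const w)

  advance-move : ∀ {zs j w s d} → Adj (zs j) w → IsDist G w s d → IsDist G (zs j) s (suc d) →
                 ZombieMove G P k zs s (advance zs j w)
  advance-move {zs} {j} {w} zj~w w-dist zj-dist i with i ≟ᶠ j
  ... | yes refl rewrite updateAt-updates i {const w} zs = inj₂ (zj~w , _ , w-dist , zj-dist)
  ... | no  i≢j  = inj₁ (updateAt-minimal i j zs i≢j)

  advance-potential : ∀ {zs j w d} → IsDist G w (target j) (suc d) →
                      IsDist G (zs j) (target j) (suc (suc d)) →
                      potential (advance zs j w) < potential zs
  advance-potential {zs} {j} {w} {d} w-dist zj-dist = sum-mono-< slack≤ j slack<
    where
    slack< : slack (advance zs j w) j < slack zs j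
    slack< rewrite updateAt-updates j {const w} zs | IsDist⇒dist≡ w-dist | IsDist⇒dist≡ zj-dist
      = n<1+n d

    slack≤ : ∀ i → slack (advance zs j w) i ≤ slack zs i
    slack≤ i with i ≟ᶠ j
    ... | yes refl = <⇒≤ slack<
    ... | no  i≢j  = ≤-reflexive (cong (λ z → dist z (target i) ∸ 1) (updateAt-minimal i j zs i≢j))

  round : ∀ zs j {d} → IsDist G (zs j) (target j) (suc d) →
          ∃ λ zs′ → ZombieMove G P k zs (target j) zs′ ×
                    (Caught G P k zs′ (target j) ⊎ potential zs′ < potential zs)
  round zs j {zero} zj-dist with IsDist-suc⇒step G zj-dist
  ... | w , zj~w , w-dist = advance zs j w , advance-move zj~w w-dist zj-dist ,
                            inj₁ (j , trans (updateAt-updates j zs) (IsDist-zero⇒≡ G w-dist))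
  round zs j {suc d} zj-dist with IsDist-suc⇒step G zj-dist
  ... | w , zj~w , w-dist = advance zs j w , advance-move zj~w w-dist zj-dist ,
                            inj₂ (advance-potential w-dist zj-dist)

  chase : ∀ t zs s → P s → potential zs ≤ t → ZombiesWin G P k (suc t) zs s
  chase t zs s ps Φ≤t with covers s ps
  ... | j , refl with dist (zs j) (target j) | dist-isDist (zs j) (target j)
  ...   | zero  | zj-dist = inj₁ (j , IsDist-zero⇒≡ G zj-dist)
  ...   | suc d | zj-dist with round zs j zj-dist
  ...     | zs′ , move , inj₁ caught = inj₂ (zs′ , move , inj₁ caught)
  ...     | zs′ , move , inj₂ Φ′<Φ with <-≤-trans Φ′<Φ Φ≤t
  ...       | s≤s Φ′≤t′ = inj₂ (zs′ , move , inj₂ λ s′ (ps′ , _) → chase _ zs′ s′ ps′ Φ′≤t′)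

  caught-if-D≡0 : D ≡ 0 → ∀ zs s → P s → Caught G P k zs s
  caught-if-D≡0 D≡0 zs s ps with covers s ps
  ... | j , refl = j , IsDist-zero⇒≡ G (subst (IsDist G (zs j) (target j)) dist≡0 (dist-isDist _ _))
    where
    dist≡0 : dist (zs j) (target j) ≡ 0
    dist≡0 = n≤0⇒n≡0 (subst (dist (zs j) (target j) ≤_) D≡0 (dist≤D _ _))

zombiesWin-coveredRegion :
  (G : Graph) {D : ℕ} (diam : IsDiameter G D) (P : Vertex G → Set) {k : ℕ}
  (target : Fin k → Vertex G) → (∀ s → P s → ∃ λ j → target j ≡ s) →
  ∀ zs s → P s → ZombiesWin G P k (k * D + 1 ∸ k) zs s
zombiesWin-coveredRegion G {zero} diam P {k} target covers zs s ps =
  subst (λ t → ZombiesWin G P k t zs s) (sym (m*0+1∸m≡0 (proj₁ (covers s ps))))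
        (caught-if-D≡0 refl zs s ps)
  where open CoveredRegion G diam P target covers
zombiesWin-coveredRegion G {suc D} diam P {k} target covers zs s ps =
  subst (λ t → ZombiesWin G P k t zs s) (sym (m*[1+n]+1∸m≡1+m*n k D))
        (chase (k * D) zs s ps (potential≤ zs))
  where open CoveredRegion G diam P target covers

lemma1 : (G : Graph) → Connected G → (D : ℕ) → IsDiameter G D →
    (X : CutDecomposition G) → (x : Fin (CutDecomposition.m X)) →
    CutDecomposition.IsLeaf X x →
    (zs : Fin (CutDecomposition.size X x) → Vertex G) →
    (s : Vertex G) → CutDecomposition.C X x s →
    ZombiesWin G (CutDecomposition.C X x) (CutDecomposition.size X x)
    (CutDecomposition.size X x * D + 1 ∸ CutDecomposition.size X x) zs s
lemma1 G _ D diam X x _ = zombiesWin-coveredRegion G diam (C x) (lookup vertices) covers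
  where
  open CutDecomposition X
  vertices : List (Vertex G)
  vertices = filter (λ v → part v ≟ᶠ x) (allFin (Graph.n G))
  covers : ∀ s → C x s → ∃ λ j → lookup vertices j ≡ s
  covers s s∈Cx = let s∈vertices = ∈-filter⁺ (λ v → part v ≟ᶠ x) (∈-allFin s) s∈Cx
                  in index s∈vertices , sym (lookup-index s∈vertices)
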